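{- As formal power series, $$\mathcal{S}(x,u)=\frac{x}{(1-u)(1-x+xt)}+\frac{xt}{(1-u)(1-x+xt)}\,\mathcal{N}(x,u).$$
   Context: $\mathbf{N}_n$ is the set of sequences $w=w_1\cdots w_n$ of nonnegative integers; $\mathsf{lar}(w)=\max_i w_i$, $\mathsf{sma}(w)=\min_i w_i$, $\mathsf{R}_{\mathsf{lar}}(w)=\max\{i:w_i=\mathsf{lar}(w)\}$, $\mathsf{R}_{\mathsf{sma}}(w)=\max\{i:w_i=\mathsf{sma}(w)\}$, $\mathsf{asc}(w)=|\{i\in[n-1]:w_i<w_{i+1}\}|$. $\mathbf{SL}_n=\{w\in\mathbf{N}_n:\mathsf{R}_{\mathsf{lar}}(w)\ge\mathsf{R}_{\mathsf{sma}}(w)\}$. For a set $X$ of sequences, $X(021)$ denotes those $w\in X$ with no indices $i<j<k$ such that $w_i<w_k<w_j$. Define $\mathcal{N}(x,u)=\sum_{n\ge1}x^n\sum_{w\in\mathbf{N}_n(021)}u^{\mathsf{lar}(w)}t^{\mathsf{asc}(w)}$ and $\mathcal{S}(x,u)=\sum_{n\ge1}x^n\sum_{w\in\mathbf{SL}_n(021)}u^{\mathsf{lar}(w)}t^{\mathsf{asc}(w)}$ (power series in $x,u,t$). -}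

module Defs where

open import Data.Nat using (ℕ; zero; suc; _∸_; _⊔_; _⊓_; _<ᵇ_; _≡ᵇ_; _≤ᵇ_)
open import Data.Bool using (Bool; true; false; _∧_; _∨_; if_then_else_)
open import Data.List using (List; []; _∷_; length; filter; map; concatMap; upTo; foldr)
open import Data.Bool.ListAction using (any)
open import Data.Integer as ℤ using (ℤ; +_)
open import Relation.Binary.PropositionalEquality using (_≡_)
open import Relation.Nullary.Decidable using (Dec; yes; no)
open import Data.Bool.Properties using (T?)

Word : Set
Word = List ℕ

words : ℕ → ℕ → List Word
words zero    m = [] ∷ []
words (suc n) m = concatMap (λ a → map (a ∷_) (words n m)) (upTo (suc m))

lar : Word → ℕ
lar = foldr _⊔_ 0

sma : Word → ℕ
sma []      = 0
sma (a ∷ w) = foldr _⊓_ a w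

-- largest 1-based index i with w_i = v (0 if none)
lastIndexAux : ℕ → ℕ → Word → ℕ
lastIndexAux v i []      = 0
lastIndexAux v i (a ∷ w) with lastIndexAux v (suc i) w
... | zero  = if a ≡ᵇ v then i else 0
... | suc r = suc r

lastIndex : ℕ → Word → ℕ
lastIndex v w = lastIndexAux v 1 w

Rlar : Word → ℕ
Rlar w = lastIndex (lar w) w

Rsma : Word → ℕ
Rsma w = lastIndex (sma w) w

asc : Word → ℕ
asc []          = 0
asc (a ∷ [])    = 0
asc (a ∷ b ∷ w) = (if a <ᵇ b then 1 else 0) Data.Nat.+ asc (b ∷ w)

between : ℕ → ℕ → ℕ → Bool
between a c b = (a <ᵇ c) ∧ (c <ᵇ b)

-- is there j < k in w with a < w_k < w_j ?
occ21above : ℕ → Word → Bool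
occ21above a []      = false
occ21above a (b ∷ w) = any (λ c → between a c b) w ∨ occ21above a w

-- w contains the pattern 021: indices i<j<k with w_i < w_k < w_j
contains021 : Word → Bool
contains021 []      = false
contains021 (a ∷ w) = occ21above a w ∨ contains021 w

avoids021 : Word → Bool
avoids021 w = if contains021 w then false else true

isSL : Word → Bool
isSL w = Rsma w ≤ᵇ Rlar w

count : (Word → Bool) → List Word → ℕ
count p ws = length (filter (λ w → T? (p w)) ws)

-- Formal power series in x, u, t with integer coefficients:
-- f a b c is the coefficient of x^a u^b t^c.

FPS : Set
FPS = ℕ → ℕ → ℕ → ℤ

infix 4 _≈_
_≈_ : FPS → FPS → Set
f ≈ g = ∀ a b c → f a b c ≡ g a b c

sumTo : ℕ → (ℕ → ℤ) → ℤ
sumTo zero    f = f 0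
sumTo (suc n) f = sumTo n f ℤ.+ f (suc n)

infixl 6 _⊕_ _⊖_
infixl 7 _⊛_

_⊕_ : FPS → FPS → FPS
(f ⊕ g) a b c = f a b c ℤ.+ g a b c

_⊖_ : FPS → FPS → FPS
(f ⊖ g) a b c = f a b c ℤ.- g a b c

_⊛_ : FPS → FPS → FPS
(f ⊛ g) a b c =
  sumTo a λ i → sumTo b λ j → sumTo c λ k →
    f i j k ℤ.* g (a ∸ i) (b ∸ j) (c ∸ k)

mono : ℕ → ℕ → ℕ → FPS
mono p q r a b c = if (a ≡ᵇ p) ∧ (b ≡ᵇ q) ∧ (c ≡ᵇ r) then + 1 else + 0

𝟙 X U T : FPS
𝟙 = mono 0 0 0
X = mono 1 0 0
U = mono 0 1 0
T = mono 0 0 1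

Den : FPS
Den = (𝟙 ⊖ U) ⊛ (𝟙 ⊖ X ⊕ X ⊛ T)

-- The generating functions.
-- Coefficient of x^n u^m t^k in 𝒩: number of w ∈ N_n(021), n ≥ 1,
-- with lar(w) = m and asc(w) = k (such w have all entries ≤ m).

𝒩 : FPS
𝒩 zero    m k = + 0
𝒩 (suc n) m k =
  + count (λ w → (lar w ≡ᵇ m) ∧ (asc w ≡ᵇ k) ∧ avoids021 w) (words (suc n) m)

𝒮 : FPS
𝒮 zero    m k = + 0
𝒮 (suc n) m k =
  + count (λ w → (lar w ≡ᵇ m) ∧ (asc w ≡ᵇ k) ∧ avoids021 w ∧ isSL w) (words (suc n) m)

-- A 021-avoiding word lies in SL exactly when it ends with its largest letter: if the
-- last letter a is below the maximum M, then the last minimum s comes after the last M,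
-- since otherwise s M a is an occurrence of 021. So deleting the final maximum m maps the
-- words of SL_{n+1}(021) with largest letter m onto the 021-avoiding words of length n
-- with letters ≤ m. Sorting these by their last letter gives
--   S(n+1, k+1) − S(n, k+1) + S(n, k) = A(n+1, k),
-- where A counts 021-avoiding words with letters ≤ m, the partial sums over the largest
-- letter of the coefficients of 𝒩. In series form, (1 − u)(1 − x + xt) 𝒮 = x (1 + t 𝒩);
-- as Den has constant term 1, multiplication by Den is cancellable, and any inverse I of
-- Den gives the closed form.

module Submission where

open import Defs
open import Data.Product using (Σ; _×_)

module WordCounts where

  open import Data.Nat using (ℕ; zero; suc; _+_; _≤_; _<_; _⊔_; _≤ᵇ_; _≡ᵇ_)
  open import Data.Nat.Properties
  open import Data.Bool as Bool using (Bool; true; false; _∧_; not)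
  open import Data.Bool.Properties using (∧-zeroʳ; ∧-identityʳ)
  open import Data.Fin using (toℕ)
  open import Data.Fin.Properties using (toℕ<n; toℕ-fromℕ; toℕ-inject₁)
  open import Data.List using (List; []; _∷_; _++_; _∷ʳ_; map; concatMap; applyUpTo; filter; length)
  open import Data.List.Properties using (filter-++; length-++)
  open import Data.List.Relation.Unary.All as All using (All; []; _∷_)
  open import Data.List.Relation.Unary.All.Properties using (concat⁺; map⁺; applyUpTo⁺₁)
  open import Algebra.Properties.CommutativeMonoid.Sum +-0-commutativeMonoid
    using (sum; sum-cong-≗; sum-init-last; ∑-comm; sum-replicate-zero)
  open import Relation.Binary.PropositionalEquality
  open import Function using (_∘_)
  open import Relation.Nullary using (¬_; yes; no)
  open import Data.Empty using (⊥-elim)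

  true-if : ∀ {b} → Bool.T b → b ≡ true
  true-if {true} _ = refl

  false-if : ∀ {b} → ¬ Bool.T b → b ≡ false
  false-if {false} _  = refl
  false-if {true}  ¬t = ⊥-elim (¬t _)

  ≡ᵇ-refl : ∀ x → (x ≡ᵇ x) ≡ true
  ≡ᵇ-refl x = true-if (≡⇒≡ᵇ x x refl)

  count-++ : ∀ p xs ys → count p (xs ++ ys) ≡ count p xs + count p ys
  count-++ p xs ys = trans (cong length (filter-++ _ xs ys)) (length-++ (filter _ xs))

  count-map : ∀ p (f : Word → Word) ws → count p (map f ws) ≡ count (λ w → p (f w)) ws
  count-map p f [] = refl
  count-map p f (w ∷ ws) with p (f w)
  ... | true  = cong suc (count-map p f ws)
  ... | false = count-map p f ws

  -- Opaque, so that the summand f can be recovered by unification from ∑< n f.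
  opaque
    ∑< : ℕ → (ℕ → ℕ) → ℕ
    ∑< n f = sum {n} (λ i → f (toℕ i))

    ∑<-last : ∀ n f → ∑< (suc n) f ≡ ∑< n f + f n
    ∑<-last n f = trans (sum-init-last {n} (λ i → f (toℕ i)))
      (cong₂ _+_ (sum-cong-≗ {n} (λ i → cong f (toℕ-inject₁ i))) (cong f (toℕ-fromℕ n)))

    ∑<-cong : ∀ n {f g : ℕ → ℕ} → (∀ a → a < n → f a ≡ g a) → ∑< n f ≡ ∑< n g
    ∑<-cong n f≡g = sum-cong-≗ {n} (λ i → f≡g (toℕ i) (toℕ<n i))

    ∑<-zero : ∀ n {f} → (∀ a → a < n → f a ≡ 0) → ∑< n f ≡ 0
    ∑<-zero n f≡0 = trans (∑<-cong n f≡0) (sum-replicate-zero n)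

    ∑<-comm : ∀ m n (f : ℕ → ℕ → ℕ) →
      ∑< m (λ a → ∑< n (f a)) ≡ ∑< n (λ b → ∑< m (λ a → f a b))
    ∑<-comm m n f = ∑-comm {m} {n} (λ i j → f (toℕ i) (toℕ j))

    count-concatMap : ∀ p (g : ℕ → List Word) h n →
      count p (concatMap g (applyUpTo h n)) ≡ ∑< n (λ a → count p (g (h a)))
    count-concatMap p g h zero    = refl
    count-concatMap p g h (suc n) = trans (count-++ p (g (h 0)) _)
      (cong (count p (g (h 0)) +_) (count-concatMap p g (λ a → h (suc a)) n))

  count-cong : ∀ {p q} {ws} → All (λ w → p w ≡ q w) ws → count p ws ≡ count q ws
  count-cong [] = refl
  count-cong {p} {q} {w ∷ ws} (e ∷ es) with p w | q w | e
  ... | true  | true  | refl = cong suc (count-cong es)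
  ... | false | false | refl = count-cong es

  count-split : ∀ (p q : Word → Bool) ws →
    count p ws ≡ count (λ w → p w ∧ q w) ws + count (λ w → p w ∧ not (q w)) ws
  count-split p q [] = refl
  count-split p q (w ∷ ws) with p w | q w
  ... | true  | true  = cong suc (count-split p q ws)
  ... | true  | false = trans (cong suc (count-split p q ws)) (sym (+-suc _ _))
  ... | false | _     = count-split p q ws

  Bounded : ℕ → Word → Set
  Bounded m = All (_≤ m)

  words-bounded : ∀ n m → All (Bounded m) (words n m)
  words-bounded zero    m = [] ∷ []
  words-bounded (suc n) m = concat⁺ (map⁺ (applyUpTo⁺₁ _ (suc m)
    (λ a<1+m → map⁺ (All.map (≤-pred a<1+m ∷_) (words-bounded n m)))))

  countWords : ℕ → ℕ → (Word → Bool) → ℕ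
  countWords n m p = count p (words n m)

  countWords-cong : ∀ n m {p q} → (∀ w → Bounded m w → p w ≡ q w) → countWords n m p ≡ countWords n m q
  countWords-cong n m e = count-cong (All.map (e _) (words-bounded n m))

  countWords-none : ∀ n m {p} → (∀ w → Bounded m w → p w ≡ false) → countWords n m p ≡ 0
  countWords-none n m {p} e = trans (countWords-cong n m e) (count-false (words n m))
    where
    count-false : ∀ ws → count (λ _ → false) ws ≡ 0
    count-false []       = refl
    count-false (_ ∷ ws) = count-false ws

  countWords-∷ : ∀ n m p → countWords (suc n) m p ≡ ∑< (suc m) (λ a → countWords n m (λ w → p (a ∷ w)))
  countWords-∷ n m p = trans (count-concatMap p (λ a → map (a ∷_) (words n m)) (λ a → a) (suc m))
    (∑<-cong (suc m) (λ a _ → count-map p (a ∷_) (words n m)))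

  countWords-∷ʳ : ∀ n m p → countWords (suc n) m p ≡ ∑< (suc m) (λ a → countWords n m (λ v → p (v ∷ʳ a)))
  countWords-∷ʳ zero    m p = trans (countWords-∷ zero m p)
    (∑<-cong (suc m) (λ a _ → count-cong {λ w → p (a ∷ w)} {λ v → p (v ∷ʳ a)} (refl ∷ [])))
  countWords-∷ʳ (suc n) m p = begin
    countWords (suc (suc n)) m p
      ≡⟨ countWords-∷ (suc n) m p ⟩
    ∑< (suc m) (λ b → countWords (suc n) m (λ w → p (b ∷ w)))
      ≡⟨ ∑<-cong (suc m) (λ b _ → countWords-∷ʳ n m (λ w → p (b ∷ w))) ⟩
    ∑< (suc m) (λ b → ∑< (suc m) (λ a → countWords n m (λ v → p (b ∷ v ∷ʳ a))))
      ≡⟨ ∑<-comm (suc m) (suc m) (λ b a → countWords n m (λ v → p (b ∷ v ∷ʳ a))) ⟩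
    ∑< (suc m) (λ a → ∑< (suc m) (λ b → countWords n m (λ v → p (b ∷ v ∷ʳ a))))
      ≡⟨ ∑<-cong (suc m) (λ a _ → sym (countWords-∷ n m (λ v → p (v ∷ʳ a)))) ⟩
    ∑< (suc m) (λ a → countWords (suc n) m (λ v → p (v ∷ʳ a)))
      ∎
    where open ≡-Reasoning

  countWords-restrict : ∀ n m q → countWords n (suc m) (λ w → q w ∧ (lar w ≤ᵇ m)) ≡ countWords n m q
  countWords-restrict zero    m q = count-cong {λ w → q w ∧ (lar w ≤ᵇ m)} {q} (∧-identityʳ (q []) ∷ [])
  countWords-restrict (suc n) m q = begin
    countWords (suc n) (suc m) (λ w → q w ∧ (lar w ≤ᵇ m))
      ≡⟨ countWords-∷ n (suc m) _ ⟩
    ∑< (suc (suc m)) (λ a → countWords n (suc m) (λ w → q (a ∷ w) ∧ (a ⊔ lar w ≤ᵇ m)))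
      ≡⟨ ∑<-last (suc m) _ ⟩
    ∑< (suc m) (λ a → countWords n (suc m) (λ w → q (a ∷ w) ∧ (a ⊔ lar w ≤ᵇ m)))
      + countWords n (suc m) (λ w → q (suc m ∷ w) ∧ (suc m ⊔ lar w ≤ᵇ m))
      ≡⟨ cong₂ _+_ (∑<-cong (suc m) (λ a a<1+m → trans
                     (countWords-cong n (suc m) (λ w _ → cong (q (a ∷ w) ∧_) (⊔-≤ᵇ (≤-pred a<1+m) (lar w))))
                     (countWords-restrict n m (λ w → q (a ∷ w)))))
                   (countWords-none n (suc m) (λ w _ →
                     trans (cong (q (suc m ∷ w) ∧_) (false-if (1+m⊔l≰m (lar w) ∘ ≤ᵇ⇒≤ _ m))) (∧-zeroʳ _))) ⟩
    ∑< (suc m) (λ a → countWords n m (λ w → q (a ∷ w))) + 0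
      ≡⟨ +-identityʳ _ ⟩
    ∑< (suc m) (λ a → countWords n m (λ w → q (a ∷ w)))
      ≡⟨ countWords-∷ n m q ⟨
    countWords (suc n) m q
      ∎
    where
    open ≡-Reasoning
    ⊔-≤ᵇ : ∀ {a} → a ≤ m → ∀ l → (a ⊔ l ≤ᵇ m) ≡ (l ≤ᵇ m)
    ⊔-≤ᵇ {a} a≤m l with l ≤? m
    ... | yes l≤m = trans (true-if (≤⇒≤ᵇ (⊔-lub a≤m l≤m))) (sym (true-if (≤⇒≤ᵇ l≤m)))
    ... | no l≰m  = trans (false-if (l≰m ∘ m⊔n≤o⇒n≤o a l ∘ ≤ᵇ⇒≤ (a ⊔ l) m))
                          (sym (false-if (l≰m ∘ ≤ᵇ⇒≤ l m)))
    1+m⊔l≰m : ∀ l → ¬ (suc m ⊔ l ≤ m)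
    1+m⊔l≰m l le = n≮n m (m⊔n≤o⇒m≤o (suc m) l le)

module SLWords where

  open WordCounts using (Bounded; true-if; false-if; ≡ᵇ-refl)
  open import Data.Nat using (ℕ; zero; suc; _+_; _≤_; _<_; s≤s; z≤n; _⊓_; _≡ᵇ_; _<ᵇ_)
  open import Data.Nat.Properties
  open import Data.Bool as Bool using (Bool; true; false; _∧_; _∨_; if_then_else_)
  open import Data.Bool.Properties using (∨-zeroʳ; ∧-zeroʳ; ∧-identityʳ)
  open import Data.Bool.ListAction using (any)
  open import Data.List using ([]; _∷_; _∷ʳ_; length; foldr)
  open import Data.List.Membership.Propositional using (_∈_)
  open import Data.List.Membership.Propositional.Properties using (∈-++⁺ʳ)
  open import Data.List.Properties using (length-++)
  open import Data.List.Relation.Unary.All using ([]; _∷_)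
  open import Data.List.Relation.Unary.Any using (here; there)
  open import Data.Empty using (⊥-elim)
  open import Data.Sum using (inj₁; inj₂)
  open import Data.Product using (_,_)
  open import Function using (_∘_; flip)
  open import Relation.Nullary using (yes; no)
  open import Relation.Binary.PropositionalEquality

  lastPos : ℕ → Word → ℕ
  lastPos x []      = 0
  lastPos x (b ∷ w) with lastPos x w
  ... | zero  = if b ≡ᵇ x then 1 else 0
  ... | suc r = suc (suc r)

  lastIndex≡lastPos : ∀ x w → lastIndex x w ≡ lastPos x w
  lastIndex≡lastPos x w = offset-zero (lastPos x w) (lastIndexAux≡offset 0 w)
    where
    offset : ℕ → ℕ → ℕ
    offset i zero    = 0
    offset i (suc r) = i + suc r

    offset-zero : ∀ r {k} → k ≡ offset 0 r → k ≡ r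
    offset-zero zero    e = e
    offset-zero (suc r) e = e

    lastIndexAux≡offset : ∀ i w → lastIndexAux x (suc i) w ≡ offset i (lastPos x w)
    lastIndexAux≡offset i []      = refl
    lastIndexAux≡offset i (b ∷ w) with lastIndexAux x (suc (suc i)) w | lastPos x w | lastIndexAux≡offset (suc i) w
    ... | zero  | zero  | _ with b ≡ᵇ x
    ...   | true  = sym (+-comm i 1)
    ...   | false = refl
    lastIndexAux≡offset i (b ∷ w) | suc _ | suc r | e = trans e (sym (+-suc i (suc r)))

  lastPos≤length : ∀ x w → lastPos x w ≤ length w
  lastPos≤length x []      = z≤n
  lastPos≤length x (b ∷ w) with lastPos x w | lastPos≤length x w
  ... | suc r | le = s≤s le
  ... | zero  | _ with b ≡ᵇ x
  ...   | true  = s≤s z≤n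
  ...   | false = z≤n

  lastPos-∷ʳ : ∀ x v → lastPos x (v ∷ʳ x) ≡ suc (length v)
  lastPos-∷ʳ x []      rewrite ≡ᵇ-refl x = refl
  lastPos-∷ʳ x (b ∷ v) with lastPos x (v ∷ʳ x) | lastPos-∷ʳ x v
  ... | suc r | e = cong suc e

  lastPos-∈ : ∀ {x w} → x ∈ w → 0 < lastPos x w
  lastPos-∈ {x} {b ∷ w} (here refl) with lastPos x w
  ... | zero rewrite ≡ᵇ-refl x = s≤s z≤n
  ... | suc r = s≤s z≤n
  lastPos-∈ {x} {b ∷ w} (there x∈w) with lastPos x w | lastPos-∈ x∈w
  ... | suc r | _ = s≤s z≤n

  lastPos-∷ : ∀ x b w → 0 < lastPos x w → lastPos x (b ∷ w) ≡ suc (lastPos x w)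
  lastPos-∷ x b w pos with lastPos x w
  ... | suc r = refl

  lastPos-∉ : ∀ x w → lar w < x → lastPos x w ≡ 0
  lastPos-∉ x []      _     = refl
  lastPos-∉ x (b ∷ w) lar<x rewrite lastPos-∉ x w (m⊔n<o⇒n<o b (lar w) lar<x) =
    cong (λ t → if t then 1 else 0) (false-if (<⇒≢ (m⊔n<o⇒m<o b (lar w) lar<x) ∘ ≡ᵇ⇒≡ b x))

  lastPos-head : ∀ x w → lastPos x w ≡ 0 → lastPos x (x ∷ w) ≡ 1
  lastPos-head x w e with lastPos x w
  ... | zero rewrite ≡ᵇ-refl x = refl

  length-∷ʳ : ∀ (v : Word) a → length (v ∷ʳ a) ≡ suc (length v)
  length-∷ʳ v a = trans (length-++ v) (+-comm (length v) 1)

  lar-upper : ∀ {x w} → x ∈ w → x ≤ lar w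
  lar-upper {w = b ∷ w} (here refl) = m≤m⊔n b (lar w)
  lar-upper {w = b ∷ w} (there x∈w) = ≤-trans (lar-upper x∈w) (m≤n⊔m b (lar w))

  lar-bounded : ∀ {m} w → Bounded m w → lar w ≤ m
  lar-bounded []      []          = z≤n
  lar-bounded (b ∷ w) (b≤m ∷ w≤m) = ⊔-lub b≤m (lar-bounded w w≤m)

  lar∈ : ∀ {x} w → x ∈ w → lar w ∈ w
  lar∈ (b ∷ [])    _ = here (⊔-identityʳ b)
  lar∈ (b ∷ w@(_ ∷ _)) _ with ⊔-sel b (lar w) | lar∈ w (here refl)
  ... | inj₁ e | _      = here e
  ... | inj₂ e | lar∈w = there (subst (_∈ w) (sym e) lar∈w)

  sma-∷ : ∀ b c w → sma (b ∷ c ∷ w) ≡ b ⊓ sma (c ∷ w)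
  sma-∷ b c []      = ⊓-comm c b
  sma-∷ b c (d ∷ w) = begin
    c ⊓ foldr _⊓_ b (d ∷ w)   ≡⟨ cong (c ⊓_) (sma-∷ b d w) ⟩
    c ⊓ (b ⊓ foldr _⊓_ d w)   ≡⟨ ⊓-assoc c b _ ⟨
    c ⊓ b ⊓ foldr _⊓_ d w     ≡⟨ cong (_⊓ foldr _⊓_ d w) (⊓-comm c b) ⟩
    b ⊓ c ⊓ foldr _⊓_ d w     ≡⟨ ⊓-assoc b c _ ⟩
    b ⊓ (c ⊓ foldr _⊓_ d w)   ≡⟨ cong (b ⊓_) (sma-∷ c d w) ⟨
    b ⊓ sma (c ∷ d ∷ w)       ∎
    where open ≡-Reasoning

  sma-∷-∷ʳ : ∀ b v a → sma (b ∷ v ∷ʳ a) ≡ b ⊓ sma (v ∷ʳ a)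
  sma-∷-∷ʳ b []      a = sma-∷ b a []
  sma-∷-∷ʳ b (c ∷ v) a = sma-∷ b c (v ∷ʳ a)

  sma-lower : ∀ {x} w → x ∈ w → sma w ≤ x
  sma-lower (b ∷ [])    (here refl) = ≤-refl
  sma-lower (b ∷ c ∷ w) (here refl) = subst (_≤ b) (sym (sma-∷ b c w)) (m⊓n≤m b _)
  sma-lower (b ∷ c ∷ w) (there x∈)  =
    subst (_≤ _) (sym (sma-∷ b c w)) (≤-trans (m⊓n≤n b _) (sma-lower (c ∷ w) x∈))

  sma∈ : ∀ {x} w → x ∈ w → sma w ∈ w
  sma∈ (b ∷ [])    _ = here refl
  sma∈ (b ∷ w@(c ∷ w')) _ with ⊓-sel b (sma w) | sma∈ w (here refl)
  ... | inj₁ e | _      = here (trans (sma-∷ b c w') e)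
  ... | inj₂ e | sma∈w = there (subst (_∈ w) (sym (trans (sma-∷ b c w') e)) sma∈w)

  any-∷ʳ : ∀ (f : ℕ → Bool) v a → f a ≡ true → any f (v ∷ʳ a) ≡ true
  any-∷ʳ f []      a fa = cong (_∨ false) fa
  any-∷ʳ f (b ∷ v) a fa = trans (cong (f b ∨_) (any-∷ʳ f v a fa)) (∨-zeroʳ (f b))

  occ21above-∷ʳ : ∀ b v a → b < a → a < lar (v ∷ʳ a) → occ21above b (v ∷ʳ a) ≡ true
  occ21above-∷ʳ b []      a b<a a<lar = ⊥-elim (<-irrefl (sym (⊔-identityʳ a)) a<lar)
  occ21above-∷ʳ b (c ∷ v) a b<a a<lar with a <? c
  ... | yes a<c = cong (_∨ occ21above b (v ∷ʳ a))
        (any-∷ʳ (λ x → between b x c) v a (cong₂ _∧_ (true-if (<⇒<ᵇ b<a)) (true-if (<⇒<ᵇ a<c))))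
  ... | no a≮c = trans (cong (any (λ x → between b x c) (v ∷ʳ a) ∨_) (occ21above-∷ʳ b v a b<a a<lar′))
                       (∨-zeroʳ _)
    where
    a<lar′ : a < lar (v ∷ʳ a)
    a<lar′ = subst (a <_) (m≤n⇒m⊔n≡n (≤-trans (≮⇒≥ a≮c) (lar-upper (∈-++⁺ʳ v (here refl))))) a<lar

  ∨-≡false : ∀ x {y} → (x ∨ y) ≡ false → x ≡ false × y ≡ false
  ∨-≡false false e = refl , e

  lastPos-lar<lastPos-sma : ∀ v a → contains021 (v ∷ʳ a) ≡ false → a < lar (v ∷ʳ a) →
    lastPos (lar (v ∷ʳ a)) (v ∷ʳ a) < lastPos (sma (v ∷ʳ a)) (v ∷ʳ a)
  lastPos-lar<lastPos-sma []      a _     a<lar = ⊥-elim (<-irrefl (sym (⊔-identityʳ a)) a<lar)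
  lastPos-lar<lastPos-sma (b ∷ v) a avoid a<lar
    with b ≤? lar (v ∷ʳ a) | sma (v ∷ʳ a) ≤? b | ∨-≡false (occ21above b (v ∷ʳ a)) avoid
  ... | no b≰M | _ | _ = subst₂ (λ l s → lastPos l w < lastPos s w) (sym lar≡b) (sym sma≡s′) 1<pos
    where
    w : Word
    w = b ∷ v ∷ʳ a
    M<b : lar (v ∷ʳ a) < b
    M<b = ≰⇒> b≰M
    s′ : ℕ
    s′ = sma (v ∷ʳ a)
    s′∈ : s′ ∈ v ∷ʳ a
    s′∈ = sma∈ (v ∷ʳ a) (∈-++⁺ʳ v (here refl))
    lar≡b : lar w ≡ b
    lar≡b = m≥n⇒m⊔n≡m (<⇒≤ M<b)
    sma≡s′ : sma w ≡ s′
    sma≡s′ = trans (sma-∷-∷ʳ b v a) (m≥n⇒m⊓n≡n (≤-trans (lar-upper s′∈) (<⇒≤ M<b)))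
    1<pos : lastPos b w < lastPos s′ w
    1<pos rewrite lastPos-head b (v ∷ʳ a) (lastPos-∉ b (v ∷ʳ a) M<b)
                | lastPos-∷ s′ b (v ∷ʳ a) (lastPos-∈ s′∈) = s≤s (lastPos-∈ s′∈)
  ... | yes b≤M | yes s≤b | _ , avoid′ =
    subst₂ (λ l s → lastPos l w < lastPos s w) (sym lar≡M) (sym sma≡s′) shifted
    where
    w : Word
    w = b ∷ v ∷ʳ a
    M s′ : ℕ
    M  = lar (v ∷ʳ a)
    s′ = sma (v ∷ʳ a)
    lar≡M : lar w ≡ M
    lar≡M = m≤n⇒m⊔n≡n b≤M
    sma≡s′ : sma w ≡ s′
    sma≡s′ = trans (sma-∷-∷ʳ b v a) (m≥n⇒m⊓n≡n s≤b)
    ih : lastPos M (v ∷ʳ a) < lastPos s′ (v ∷ʳ a)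
    ih = lastPos-lar<lastPos-sma v a avoid′ (subst (a <_) lar≡M a<lar)
    shifted : lastPos M w < lastPos s′ w
    shifted rewrite lastPos-∷ M b (v ∷ʳ a) (lastPos-∈ (lar∈ (v ∷ʳ a) (∈-++⁺ʳ v (here refl))))
                  | lastPos-∷ s′ b (v ∷ʳ a) (≤-trans (s≤s z≤n) ih) = s≤s ih
  ... | yes b≤M | no s≰b | no-occ , _ = ⊥-elim (true≢false (trans (sym occ) no-occ))
    where
    true≢false : true ≢ false
    true≢false ()
    occ : occ21above b (v ∷ʳ a) ≡ true
    occ = occ21above-∷ʳ b v a (<-≤-trans (≰⇒> s≰b) (sma-lower (v ∷ʳ a) (∈-++⁺ʳ v (here refl))))
                            (subst (a <_) (m≤n⇒m⊔n≡n b≤M) a<lar)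

  isSL-lastIsMax : ∀ v a → lar (v ∷ʳ a) ≡ a → isSL (v ∷ʳ a) ≡ true
  isSL-lastIsMax v a lar≡a = true-if (≤⇒≤ᵇ (begin
    Rsma w                ≡⟨ lastIndex≡lastPos (sma w) w ⟩
    lastPos (sma w) w     ≤⟨ lastPos≤length (sma w) w ⟩
    length w              ≡⟨ length-∷ʳ v a ⟩
    suc (length v)        ≡⟨ lastPos-∷ʳ a v ⟨
    lastPos a w           ≡⟨ cong (λ l → lastPos l w) lar≡a ⟨
    lastPos (lar w) w     ≡⟨ lastIndex≡lastPos (lar w) w ⟨
    Rlar w                ∎))
    where
    open ≤-Reasoning
    w : Word
    w = v ∷ʳ a

  isSL-lastBelowMax : ∀ v a → contains021 (v ∷ʳ a) ≡ false → a < lar (v ∷ʳ a) → isSL (v ∷ʳ a) ≡ false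
  isSL-lastBelowMax v a avoid a<lar = false-if (<⇒≱ Rlar<Rsma ∘ ≤ᵇ⇒≤ _ _)
    where
    w : Word
    w = v ∷ʳ a
    Rlar<Rsma : Rlar w < Rsma w
    Rlar<Rsma = subst₂ _<_ (sym (lastIndex≡lastPos (lar w) w)) (sym (lastIndex≡lastPos (sma w) w))
                  (lastPos-lar<lastPos-sma v a avoid a<lar)

  inSL⇔endsWithMax : ∀ m q v a → Bounded m (v ∷ʳ a) →
    ((lar (v ∷ʳ a) ≡ᵇ m) ∧ q ∧ avoids021 (v ∷ʳ a) ∧ isSL (v ∷ʳ a))
      ≡ ((a ≡ᵇ m) ∧ q ∧ avoids021 (v ∷ʳ a))
  inSL⇔endsWithMax m q v a bounded with a ≟ m
  ... | yes refl = begin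
    (lar w ≡ᵇ a) ∧ q ∧ avoids021 w ∧ isSL w
      ≡⟨ cong (λ l → (l ≡ᵇ a) ∧ q ∧ avoids021 w ∧ isSL w) lar≡a ⟩
    (a ≡ᵇ a) ∧ q ∧ avoids021 w ∧ isSL w
      ≡⟨ cong (λ t → (a ≡ᵇ a) ∧ q ∧ avoids021 w ∧ t) (isSL-lastIsMax v a lar≡a) ⟩
    (a ≡ᵇ a) ∧ q ∧ avoids021 w ∧ true
      ≡⟨ cong (λ t → (a ≡ᵇ a) ∧ q ∧ t) (∧-identityʳ _) ⟩
    (a ≡ᵇ a) ∧ q ∧ avoids021 w
      ∎
    where
    open ≡-Reasoning
    w : Word
    w = v ∷ʳ a
    lar≡a : lar w ≡ a
    lar≡a = ≤-antisym (lar-bounded w bounded) (lar-upper (∈-++⁺ʳ v (here refl)))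
  ... | no a≢m rewrite false-if (a≢m ∘ ≡ᵇ⇒≡ a m) with lar (v ∷ʳ a) ≟ m
  ...   | no lar≢m rewrite false-if (lar≢m ∘ ≡ᵇ⇒≡ (lar (v ∷ʳ a)) m) = refl
  ...   | yes lar≡m rewrite true-if (≡⇒≡ᵇ _ _ lar≡m) with contains021 (v ∷ʳ a) in eq
  ...     | true  = ∧-zeroʳ q
  ...     | false rewrite isSL-lastBelowMax v a eq
                        (≤∧≢⇒< (lar-upper (∈-++⁺ʳ v (here refl))) (a≢m ∘ flip trans lar≡m)) = ∧-zeroʳ q

  any-∷ʳ-false : ∀ (f : ℕ → Bool) v a → f a ≡ false → any f (v ∷ʳ a) ≡ any f v
  any-∷ʳ-false f []      a fa = cong (_∨ false) fa
  any-∷ʳ-false f (b ∷ v) a fa = cong (f b ∨_) (any-∷ʳ-false f v a fa)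

  occ21above-∷ʳ-max : ∀ {m} x v → Bounded m v → occ21above x (v ∷ʳ m) ≡ occ21above x v
  occ21above-∷ʳ-max         x []      []            = refl
  occ21above-∷ʳ-max {m = m} x (b ∷ v) (b≤m ∷ v≤m) = cong₂ _∨_
    (any-∷ʳ-false (λ c → between x c b) v m
      (trans (cong ((x <ᵇ m) ∧_) (false-if (≤⇒≯ b≤m ∘ <ᵇ⇒< m b))) (∧-zeroʳ _)))
    (occ21above-∷ʳ-max x v v≤m)

  contains021-∷ʳ-max : ∀ {m} v → Bounded m v → contains021 (v ∷ʳ m) ≡ contains021 v
  contains021-∷ʳ-max []      []          = refl
  contains021-∷ʳ-max (b ∷ v) (_ ∷ v≤m) =
    cong₂ _∨_ (occ21above-∷ʳ-max b v v≤m) (contains021-∷ʳ-max v v≤m)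

  avoids021-∷ʳ-max : ∀ {m} v → Bounded m v → avoids021 (v ∷ʳ m) ≡ avoids021 v
  avoids021-∷ʳ-max v v≤m = cong (λ t → if t then false else true) (contains021-∷ʳ-max v v≤m)

  asc-∷ʳ : ∀ v a b → asc (v ∷ʳ a ∷ʳ b) ≡ asc (v ∷ʳ a) + (if a <ᵇ b then 1 else 0)
  asc-∷ʳ []          a b = +-identityʳ _
  asc-∷ʳ (c ∷ [])    a b = trans (cong ((if c <ᵇ a then 1 else 0) +_) (+-identityʳ _))
                                 (cong (_+ (if a <ᵇ b then 1 else 0)) (sym (+-identityʳ _)))
  asc-∷ʳ (c ∷ d ∷ v) a b = trans (cong ((if c <ᵇ d then 1 else 0) +_) (asc-∷ʳ (d ∷ v) a b))
                                 (sym (+-assoc (if c <ᵇ d then 1 else 0) _ _))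

module Recurrences where

  open WordCounts
  open SLWords
  open import Data.Nat using (ℕ; suc; _+_; _≤_; _<_; _≡ᵇ_; _≤ᵇ_)
  open import Data.Nat.Properties
  open import Data.Bool using (Bool; false; _∧_; not; if_then_else_)
  open import Data.Bool.Properties using (∧-zeroʳ; ∧-identityʳ)
  open import Data.List using (_∷ʳ_)
  open import Data.List.Relation.Unary.All.Properties using (∷ʳ⁺)
  open import Function using (_∘_)
  open import Data.Nat.Tactic.RingSolver using (solve-∀)
  open import Relation.Nullary using (yes; no)
  open import Relation.Binary.PropositionalEquality

  slCount : ℕ → ℕ → ℕ → ℕ
  slCount n m k = countWords n m (λ v → (asc (v ∷ʳ m) ≡ᵇ k) ∧ avoids021 v)

  avoidCount : ℕ → ℕ → ℕ → ℕ
  avoidCount n m k = countWords n m (λ w → (asc w ≡ᵇ k) ∧ avoids021 w)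

  countWords-SL : ∀ n m k →
    countWords (suc n) m (λ w → (lar w ≡ᵇ m) ∧ (asc w ≡ᵇ k) ∧ avoids021 w ∧ isSL w) ≡ slCount n m k
  countWords-SL n m k = begin
    countWords (suc n) m SL
      ≡⟨ countWords-∷ʳ n m SL ⟩
    ∑< (suc m) (λ a → countWords n m (λ v → SL (v ∷ʳ a)))
      ≡⟨ ∑<-last m _ ⟩
    ∑< m (λ a → countWords n m (λ v → SL (v ∷ʳ a))) + countWords n m (λ v → SL (v ∷ʳ m))
      ≡⟨ cong₂ _+_ (∑<-zero m (λ a a<m → countWords-none n m (λ v v≤m → lastBelowMax a a<m v v≤m)))
                   (countWords-cong n m lastIsMax) ⟩
    slCount n m k
      ∎
    where
    open ≡-Reasoning
    SL : Word → Bool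
    SL w = (lar w ≡ᵇ m) ∧ (asc w ≡ᵇ k) ∧ avoids021 w ∧ isSL w
    lastBelowMax : ∀ a → a < m → ∀ v → Bounded m v → SL (v ∷ʳ a) ≡ false
    lastBelowMax a a<m v v≤m =
      trans (inSL⇔endsWithMax m (asc (v ∷ʳ a) ≡ᵇ k) v a (∷ʳ⁺ v≤m (<⇒≤ a<m)))
            (cong (_∧ ((asc (v ∷ʳ a) ≡ᵇ k) ∧ avoids021 (v ∷ʳ a))) (false-if (<⇒≢ a<m ∘ ≡ᵇ⇒≡ a m)))
    lastIsMax : ∀ v → Bounded m v → SL (v ∷ʳ m) ≡ ((asc (v ∷ʳ m) ≡ᵇ k) ∧ avoids021 v)
    lastIsMax v v≤m = begin
      SL (v ∷ʳ m)
        ≡⟨ inSL⇔endsWithMax m (asc (v ∷ʳ m) ≡ᵇ k) v m (∷ʳ⁺ v≤m ≤-refl) ⟩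
      (m ≡ᵇ m) ∧ (asc (v ∷ʳ m) ≡ᵇ k) ∧ avoids021 (v ∷ʳ m)
        ≡⟨ cong (λ t → t ∧ (asc (v ∷ʳ m) ≡ᵇ k) ∧ avoids021 (v ∷ʳ m)) (≡ᵇ-refl m) ⟩
      (asc (v ∷ʳ m) ≡ᵇ k) ∧ avoids021 (v ∷ʳ m)
        ≡⟨ cong ((asc (v ∷ʳ m) ≡ᵇ k) ∧_) (avoids021-∷ʳ-max v v≤m) ⟩
      (asc (v ∷ʳ m) ≡ᵇ k) ∧ avoids021 v
        ∎

  endingBelowMax : ℕ → ℕ → (ℕ → Bool) → ℕ
  endingBelowMax n m f = ∑< m (λ a → countWords n m (λ u → f (asc (u ∷ʳ a)) ∧ avoids021 (u ∷ʳ a)))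

  slCount-suc : ∀ n m k → slCount (suc n) m k ≡ endingBelowMax n m (λ j → suc j ≡ᵇ k) + slCount n m k
  slCount-suc n m k = begin
    slCount (suc n) m k
      ≡⟨ countWords-∷ʳ n m P ⟩
    ∑< (suc m) (λ a → countWords n m (λ u → P (u ∷ʳ a)))
      ≡⟨ ∑<-last m _ ⟩
    ∑< m (λ a → countWords n m (λ u → P (u ∷ʳ a))) + countWords n m (λ u → P (u ∷ʳ m))
      ≡⟨ cong₂ _+_
           (∑<-cong m (λ a a<m → countWords-cong n m (λ u _ → cong (λ j → (j ≡ᵇ k) ∧ _) (ascent a<m u))))
           (countWords-cong n m (λ u u≤m → cong₂ _∧_ (cong (_≡ᵇ k) (noAscent u)) (avoids021-∷ʳ-max u u≤m))) ⟩
    endingBelowMax n m (λ j → suc j ≡ᵇ k) + slCount n m k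
      ∎
    where
    open ≡-Reasoning
    P : Word → Bool
    P v = (asc (v ∷ʳ m) ≡ᵇ k) ∧ avoids021 v
    ascent : ∀ {a} → a < m → ∀ u → asc (u ∷ʳ a ∷ʳ m) ≡ suc (asc (u ∷ʳ a))
    ascent {a} a<m u = trans (asc-∷ʳ u a m)
      (trans (cong (λ t → asc (u ∷ʳ a) + (if t then 1 else 0)) (true-if (<⇒<ᵇ a<m))) (+-comm _ 1))
    noAscent : ∀ u → asc (u ∷ʳ m ∷ʳ m) ≡ asc (u ∷ʳ m)
    noAscent u = trans (asc-∷ʳ u m m)
      (trans (cong (λ t → asc (u ∷ʳ m) + (if t then 1 else 0)) (false-if (n≮n m ∘ <ᵇ⇒< m m))) (+-identityʳ _))

  avoidCount-suc : ∀ n m k → avoidCount (suc n) m k ≡ endingBelowMax n m (_≡ᵇ k) + slCount n m k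
  avoidCount-suc n m k = begin
    avoidCount (suc n) m k
      ≡⟨ countWords-∷ʳ n m P ⟩
    ∑< (suc m) (λ a → countWords n m (λ u → P (u ∷ʳ a)))
      ≡⟨ ∑<-last m _ ⟩
    endingBelowMax n m (_≡ᵇ k) + countWords n m (λ u → P (u ∷ʳ m))
      ≡⟨ cong (endingBelowMax n m (_≡ᵇ k) +_)
              (countWords-cong n m (λ u u≤m → cong ((asc (u ∷ʳ m) ≡ᵇ k) ∧_) (avoids021-∷ʳ-max u u≤m))) ⟩
    endingBelowMax n m (_≡ᵇ k) + slCount n m k
      ∎
    where
    open ≡-Reasoning
    P : Word → Bool
    P w = (asc w ≡ᵇ k) ∧ avoids021 w

  slCount-suc-zero : ∀ n m → slCount (suc n) m 0 ≡ slCount n m 0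
  slCount-suc-zero n m = trans (slCount-suc n m 0)
    (cong (_+ slCount n m 0) (∑<-zero m (λ a _ → countWords-none n m (λ _ _ → refl))))

  slCount-suc-suc : ∀ n m k → slCount (suc n) m (suc k) + slCount n m k ≡ slCount n m (suc k) + avoidCount (suc n) m k
  slCount-suc-suc n m k rewrite slCount-suc n m (suc k) | avoidCount-suc n m k =
    rearrange (endingBelowMax n m (_≡ᵇ k)) (slCount n m (suc k)) (slCount n m k)
    where
    rearrange : ∀ b s₁ s₀ → b + s₁ + s₀ ≡ s₁ + (b + s₀)
    rearrange = solve-∀

  avoidCount-zero : ∀ n k →
    avoidCount n 0 k ≡ countWords n 0 (λ w → (lar w ≡ᵇ 0) ∧ (asc w ≡ᵇ k) ∧ avoids021 w)
  avoidCount-zero n k = countWords-cong n 0 (λ w w≤0 →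
    cong (_∧ ((asc w ≡ᵇ k) ∧ avoids021 w)) (sym (true-if (≡⇒≡ᵇ _ 0 (n≤0⇒n≡0 (lar-bounded w w≤0))))))

  avoidCount-suc-max : ∀ n m k → avoidCount n (suc m) k ≡
    avoidCount n m k + countWords n (suc m) (λ w → (lar w ≡ᵇ suc m) ∧ (asc w ≡ᵇ k) ∧ avoids021 w)
  avoidCount-suc-max n m k = trans (count-split _ (λ w → lar w ≤ᵇ m) (words n (suc m)))
    (cong₂ _+_ (countWords-restrict n m _)
               (countWords-cong n (suc m) (λ w w≤1+m → maxIs1+m (lar w) (lar-bounded w w≤1+m))))
    where
    maxIs1+m : ∀ {x} l → l ≤ suc m → (x ∧ not (l ≤ᵇ m)) ≡ ((l ≡ᵇ suc m) ∧ x)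
    maxIs1+m {x} l l≤1+m with l ≟ suc m
    ... | yes refl rewrite false-if (n≮n m ∘ ≤ᵇ⇒≤ (suc m) m) | ≡ᵇ-refl m = ∧-identityʳ x
    ... | no l≢1+m rewrite false-if (l≢1+m ∘ ≡ᵇ⇒≡ l (suc m))
                         | true-if (≤⇒≤ᵇ (≤-pred (≤∧≢⇒< l≤1+m l≢1+m))) = ∧-zeroʳ x

module PowerSeries where

  open import Data.Nat as ℕ using (ℕ; zero; suc; _∸_)
  open import Data.Integer as ℤ using (ℤ; +_; _+_; _*_; -_; _-_)
  import Data.Integer.Properties as ℤ
  open import Data.Integer.Tactic.RingSolver using (solve-∀)
  open import Relation.Binary.Bundles using (Setoid)
  open import Relation.Binary.PropositionalEquality
  open import Function using (_∘_)
  open import Algebra.Bundles using (AbelianGroup)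
  open import Algebra.Properties.Group (AbelianGroup.group ℤ.+-0-abelianGroup)
    using () renaming (∙-cancelʳ to +-cancelʳ)

  sumTo-cong : ∀ n {f g : ℕ → ℤ} → (∀ i → f i ≡ g i) → sumTo n f ≡ sumTo n g
  sumTo-cong zero    f≡g = f≡g 0
  sumTo-cong (suc n) f≡g = cong₂ _+_ (sumTo-cong n f≡g) (f≡g (suc n))

  sumTo-distrib-+ : ∀ n (f g : ℕ → ℤ) → sumTo n (λ i → f i + g i) ≡ sumTo n f + sumTo n g
  sumTo-distrib-+ zero    f g = refl
  sumTo-distrib-+ (suc n) f g = trans (cong (_+ (f (suc n) + g (suc n))) (sumTo-distrib-+ n f g))
    (interchange (sumTo n f) (sumTo n g) (f (suc n)) (g (suc n)))
    where
    interchange : ∀ a b c d → a + b + (c + d) ≡ a + c + (b + d)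
    interchange = solve-∀

  sumTo-distrib-- : ∀ n (f g : ℕ → ℤ) → sumTo n (λ i → f i - g i) ≡ sumTo n f - sumTo n g
  sumTo-distrib-- zero    f g = refl
  sumTo-distrib-- (suc n) f g = trans (cong (_+ (f (suc n) - g (suc n))) (sumTo-distrib-- n f g))
    (interchange (sumTo n f) (sumTo n g) (f (suc n)) (g (suc n)))
    where
    interchange : ∀ a b c d → a - b + (c - d) ≡ a + c - (b + d)
    interchange = solve-∀

  sumTo-zero : ∀ n {f : ℕ → ℤ} → (∀ i → f i ≡ + 0) → sumTo n f ≡ + 0
  sumTo-zero zero    f≡0 = f≡0 0
  sumTo-zero (suc n) f≡0 = cong₂ _+_ (sumTo-zero n f≡0) (f≡0 (suc n))

  sumTo-suc : ∀ n (f : ℕ → ℤ) → sumTo (suc n) f ≡ f 0 + sumTo n (λ i → f (suc i))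
  sumTo-suc zero    f = refl
  sumTo-suc (suc n) f = trans (cong (_+ f (suc (suc n))) (sumTo-suc n f)) (ℤ.+-assoc (f 0) _ _)

  sumTo-shift : ∀ n (f : ℕ → ℤ) → f 0 ≡ + 0 → sumTo (suc n) f ≡ sumTo n (λ i → f (suc i))
  sumTo-shift n f f0≡0 = trans (sumTo-suc n f) (trans (cong (_+ sumTo n (λ i → f (suc i))) f0≡0) (ℤ.+-identityˡ _))

  sumTo-head : ∀ n (f : ℕ → ℤ) → (∀ i → f (suc i) ≡ + 0) → sumTo n f ≡ f 0
  sumTo-head zero    f _     = refl
  sumTo-head (suc n) f f≡0 = trans (sumTo-suc n f)
    (trans (cong (λ s → f 0 + s) (sumTo-zero n f≡0)) (ℤ.+-identityʳ (f 0)))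

  ≈-setoid : Setoid _ _
  ≈-setoid = record
    { Carrier       = FPS
    ; _≈_           = _≈_
    ; isEquivalence = record
      { refl  = λ _ _ _ → refl
      ; sym   = λ F≈G a b c → sym (F≈G a b c)
      ; trans = λ F≈G G≈H a b c → trans (F≈G a b c) (G≈H a b c)
      }
    }

  open Setoid ≈-setoid public using () renaming (sym to ≈-sym; trans to ≈-trans)

  ⊕-cong : ∀ {F F′ G G′} → F ≈ F′ → G ≈ G′ → F ⊕ G ≈ F′ ⊕ G′
  ⊕-cong F≈ G≈ a b c = cong₂ _+_ (F≈ a b c) (G≈ a b c)

  ⊖-cong : ∀ {F F′ G G′} → F ≈ F′ → G ≈ G′ → F ⊖ G ≈ F′ ⊖ G′
  ⊖-cong F≈ G≈ a b c = cong₂ _-_ (F≈ a b c) (G≈ a b c)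

  ⊖-congʳ : ∀ F {G G′} → G ≈ G′ → F ⊖ G ≈ F ⊖ G′
  ⊖-congʳ F G≈ a b c = cong (λ g → F a b c - g) (G≈ a b c)

  ⊛-congʳ : ∀ H {F G} → F ≈ G → F ⊛ H ≈ G ⊛ H
  ⊛-congʳ H F≈G a b c = sumTo-cong a λ i → sumTo-cong b λ j → sumTo-cong c λ k →
    cong (_* H (a ∸ i) (b ∸ j) (c ∸ k)) (F≈G i j k)

  ⊛-distribʳ-⊕ : ∀ H F G → (F ⊕ G) ⊛ H ≈ F ⊛ H ⊕ G ⊛ H
  ⊛-distribʳ-⊕ H F G a b c =
    trans (sumTo-cong a λ i → trans (sumTo-cong b λ j →
            trans (sumTo-cong c λ k → ℤ.*-distribʳ-+ (H (a ∸ i) (b ∸ j) (c ∸ k)) (F i j k) (G i j k))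
                  (sumTo-distrib-+ c _ _))
            (sumTo-distrib-+ b _ _))
          (sumTo-distrib-+ a _ _)

  ⊛-distribʳ-⊖ : ∀ H F G → (F ⊖ G) ⊛ H ≈ F ⊛ H ⊖ G ⊛ H
  ⊛-distribʳ-⊖ H F G a b c =
    trans (sumTo-cong a λ i → trans (sumTo-cong b λ j →
            trans (sumTo-cong c λ k → *-distribʳ-- (H (a ∸ i) (b ∸ j) (c ∸ k)) (F i j k) (G i j k))
                  (sumTo-distrib-- c _ _))
            (sumTo-distrib-- b _ _))
          (sumTo-distrib-- a _ _)
    where
    *-distribʳ-- : ∀ h f g → (f - g) * h ≡ f * h - g * h
    *-distribʳ-- = solve-∀

  -- Multiplication by x, u and t is realised as a shift of coefficients, and multiplication
  -- by Den through these shifts, so only left-multiplication properties of ⊛ are needed;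
  -- associativity of ⊛ is never proved.
  infixr 8 x·_ u·_ t·_

  x·_ u·_ t·_ : FPS → FPS
  (x· F) zero    b c = + 0
  (x· F) (suc a) b c = F a b c
  (u· F) a zero    c = + 0
  (u· F) a (suc b) c = F a b c
  (t· F) a b zero    = + 0
  (t· F) a b (suc c) = F a b c

  x·-cong : ∀ {F G} → F ≈ G → x· F ≈ x· G
  x·-cong F≈G zero    b c = refl
  x·-cong F≈G (suc a) b c = F≈G a b c

  u·-cong : ∀ {F G} → F ≈ G → u· F ≈ u· G
  u·-cong F≈G a zero    c = refl
  u·-cong F≈G a (suc b) c = F≈G a b c

  t·-cong : ∀ {F G} → F ≈ G → t· F ≈ t· G
  t·-cong F≈G a b zero    = refl
  t·-cong F≈G a b (suc c) = F≈G a b c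

  x·-distrib-⊕ : ∀ F G → x· (F ⊕ G) ≈ x· F ⊕ x· G
  x·-distrib-⊕ F G zero    b c = refl
  x·-distrib-⊕ F G (suc a) b c = refl

  u·-distrib-⊕ : ∀ F G → u· (F ⊕ G) ≈ u· F ⊕ u· G
  u·-distrib-⊕ F G a zero    c = refl
  u·-distrib-⊕ F G a (suc b) c = refl

  t·-distrib-⊕ : ∀ F G → t· (F ⊕ G) ≈ t· F ⊕ t· G
  t·-distrib-⊕ F G a b zero    = refl
  t·-distrib-⊕ F G a b (suc c) = refl

  𝟙-⊛ : ∀ H → 𝟙 ⊛ H ≈ H
  𝟙-⊛ H a b c =
    trans (sumTo-head a _ (λ i → sumTo-zero b λ j → sumTo-zero c λ k → refl))
    (trans (sumTo-head b _ (λ j → sumTo-zero c λ k → refl))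
    (trans (sumTo-head c _ (λ k → refl)) (ℤ.*-identityˡ (H a b c))))

  x·-⊛ : ∀ G H → x· G ⊛ H ≈ x· (G ⊛ H)
  x·-⊛ G H zero    b c = sumTo-zero b λ j → sumTo-zero c λ k → refl
  x·-⊛ G H (suc a) b c =
    sumTo-shift a (λ i → sumTo b λ j → sumTo c λ k → (x· G) i j k * H (suc a ∸ i) (b ∸ j) (c ∸ k))
      (sumTo-zero b λ j → sumTo-zero c λ k → refl)

  u·-⊛ : ∀ G H → u· G ⊛ H ≈ u· (G ⊛ H)
  u·-⊛ G H a zero    c = sumTo-zero a λ i → sumTo-zero c λ k → refl
  u·-⊛ G H a (suc b) c = sumTo-cong a λ i →
    sumTo-shift b (λ j → sumTo c λ k → (u· G) i j k * H (a ∸ i) (suc b ∸ j) (c ∸ k))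
      (sumTo-zero c λ k → refl)

  t·-⊛ : ∀ G H → t· G ⊛ H ≈ t· (G ⊛ H)
  t·-⊛ G H a b zero    = sumTo-zero a λ i → sumTo-zero b λ j → refl
  t·-⊛ G H a b (suc c) = sumTo-cong a λ i → sumTo-cong b λ j →
    sumTo-shift c (λ k → (t· G) i j k * H (a ∸ i) (b ∸ j) (suc c ∸ k)) refl

  X≈x·𝟙 : X ≈ x· 𝟙
  X≈x·𝟙 zero    b c = refl
  X≈x·𝟙 (suc a) b c = refl

  U≈u·𝟙 : U ≈ u· 𝟙
  U≈u·𝟙 zero    zero    c = refl
  U≈u·𝟙 zero    (suc b) c = refl
  U≈u·𝟙 (suc a) zero    c = refl
  U≈u·𝟙 (suc a) (suc b) c = refl

  T≈t·𝟙 : T ≈ t· 𝟙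
  T≈t·𝟙 zero    zero    zero    = refl
  T≈t·𝟙 zero    zero    (suc c) = refl
  T≈t·𝟙 zero    (suc b) zero    = refl
  T≈t·𝟙 zero    (suc b) (suc c) = refl
  T≈t·𝟙 (suc a) zero    zero    = refl
  T≈t·𝟙 (suc a) zero    (suc c) = refl
  T≈t·𝟙 (suc a) (suc b) zero    = refl
  T≈t·𝟙 (suc a) (suc b) (suc c) = refl

  X-⊛ : ∀ H → X ⊛ H ≈ x· H
  X-⊛ H = ≈-trans (⊛-congʳ H X≈x·𝟙) (≈-trans (x·-⊛ 𝟙 H) (x·-cong (𝟙-⊛ H)))

  U-⊛ : ∀ H → U ⊛ H ≈ u· H
  U-⊛ H = ≈-trans (⊛-congʳ H U≈u·𝟙) (≈-trans (u·-⊛ 𝟙 H) (u·-cong (𝟙-⊛ H)))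

  T-⊛ : ∀ H → T ⊛ H ≈ t· H
  T-⊛ H = ≈-trans (⊛-congʳ H T≈t·𝟙) (≈-trans (t·-⊛ 𝟙 H) (t·-cong (𝟙-⊛ H)))

  infixr 8 [1-x+xt]·_ [1-u]·_ Den·_

  [1-x+xt]·_ [1-u]·_ Den·_ : FPS → FPS
  [1-x+xt]· F = F ⊖ x· F ⊕ x· t· F
  [1-u]·    F = F ⊖ u· F
  Den·      F = [1-u]· [1-x+xt]· F

  [1-x+xt]·-cong : ∀ {F G} → F ≈ G → [1-x+xt]· F ≈ [1-x+xt]· G
  [1-x+xt]·-cong F≈G = ⊕-cong (⊖-cong F≈G (x·-cong F≈G)) (x·-cong (t·-cong F≈G))

  [1-u]·-cong : ∀ {F G} → F ≈ G → [1-u]· F ≈ [1-u]· G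
  [1-u]·-cong F≈G = ⊖-cong F≈G (u·-cong F≈G)

  Den·-cong : ∀ {F G} → F ≈ G → Den· F ≈ Den· G
  Den·-cong = [1-u]·-cong ∘ [1-x+xt]·-cong

  [1-x+xt]·-⊛ : ∀ G H → ([1-x+xt]· G) ⊛ H ≈ [1-x+xt]· (G ⊛ H)
  [1-x+xt]·-⊛ G H = ≈-trans (⊛-distribʳ-⊕ H (G ⊖ x· G) (x· t· G)) (⊕-cong
    (≈-trans (⊛-distribʳ-⊖ H G (x· G)) (⊖-congʳ (G ⊛ H) (x·-⊛ G H)))
    (≈-trans (x·-⊛ (t· G) H) (x·-cong (t·-⊛ G H))))

  [1-u]·-⊛ : ∀ G H → ([1-u]· G) ⊛ H ≈ [1-u]· (G ⊛ H)
  [1-u]·-⊛ G H = ≈-trans (⊛-distribʳ-⊖ H G (u· G)) (⊖-congʳ (G ⊛ H) (u·-⊛ G H))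

  Den·-⊛ : ∀ G H → (Den· G) ⊛ H ≈ Den· (G ⊛ H)
  Den·-⊛ G H = ≈-trans ([1-u]·-⊛ ([1-x+xt]· G) H) ([1-u]·-cong ([1-x+xt]·-⊛ G H))

  Den-⊛ : ∀ F → Den ⊛ F ≈ Den· F
  Den-⊛ F = begin
    ((𝟙 ⊖ U) ⊛ E) ⊛ F   ≈⟨ ⊛-congʳ F (𝟙⊖U-⊛ E) ⟩
    ([1-u]· E) ⊛ F      ≈⟨ [1-u]·-⊛ E F ⟩
    [1-u]· (E ⊛ F)      ≈⟨ [1-u]·-cong E-⊛ ⟩
    Den· F              ∎
    where
    open import Relation.Binary.Reasoning.Setoid ≈-setoid
    E : FPS
    E = 𝟙 ⊖ X ⊕ X ⊛ T
    𝟙⊖U-⊛ : ∀ G → (𝟙 ⊖ U) ⊛ G ≈ [1-u]· G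
    𝟙⊖U-⊛ G = ≈-trans (⊛-distribʳ-⊖ G 𝟙 U) (⊖-cong (𝟙-⊛ G) (U-⊛ G))
    E-⊛ : E ⊛ F ≈ [1-x+xt]· F
    E-⊛ = ≈-trans (⊛-distribʳ-⊕ F (𝟙 ⊖ X) (X ⊛ T)) (⊕-cong
      (≈-trans (⊛-distribʳ-⊖ F 𝟙 X) (⊖-cong (𝟙-⊛ F) (X-⊛ F)))
      (≈-trans (⊛-congʳ F (X-⊛ T)) (≈-trans (x·-⊛ T F) (x·-cong (T-⊛ F)))))

  [1-x+xt]·-x· : ∀ F → [1-x+xt]· x· F ≈ x· [1-x+xt]· F
  [1-x+xt]·-x· F zero          b c       = refl
  [1-x+xt]·-x· F (suc zero)    b zero    = refl
  [1-x+xt]·-x· F (suc zero)    b (suc c) = refl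
  [1-x+xt]·-x· F (suc (suc a)) b zero    = refl
  [1-x+xt]·-x· F (suc (suc a)) b (suc c) = refl

  [1-x+xt]·-t· : ∀ F → [1-x+xt]· t· F ≈ t· [1-x+xt]· F
  [1-x+xt]·-t· F zero    b zero          = refl
  [1-x+xt]·-t· F zero    b (suc c)       = refl
  [1-x+xt]·-t· F (suc a) b zero          = refl
  [1-x+xt]·-t· F (suc a) b (suc zero)    = refl
  [1-x+xt]·-t· F (suc a) b (suc (suc c)) = refl

  [1-u]·-x· : ∀ F → [1-u]· x· F ≈ x· [1-u]· F
  [1-u]·-x· F zero    zero    c = refl
  [1-u]·-x· F zero    (suc b) c = refl
  [1-u]·-x· F (suc a) zero    c = refl
  [1-u]·-x· F (suc a) (suc b) c = refl

  [1-u]·-t· : ∀ F → [1-u]· t· F ≈ t· [1-u]· F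
  [1-u]·-t· F a zero    zero    = refl
  [1-u]·-t· F a zero    (suc c) = refl
  [1-u]·-t· F a (suc b) zero    = refl
  [1-u]·-t· F a (suc b) (suc c) = refl

  Den·-x· : ∀ F → Den· x· F ≈ x· Den· F
  Den·-x· F = ≈-trans ([1-u]·-cong ([1-x+xt]·-x· F)) ([1-u]·-x· ([1-x+xt]· F))

  Den·-t· : ∀ F → Den· t· F ≈ t· Den· F
  Den·-t· F = ≈-trans ([1-u]·-cong ([1-x+xt]·-t· F)) ([1-u]·-t· ([1-x+xt]· F))

  [1-x+xt]·-distrib-⊕ : ∀ F G → [1-x+xt]· (F ⊕ G) ≈ [1-x+xt]· F ⊕ [1-x+xt]· G
  [1-x+xt]·-distrib-⊕ F G a b c =
    trans (cong₂ (λ p q → F a b c + G a b c - p + q) (x·-distrib-⊕ F G a b c)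
                 (trans (x·-cong (t·-distrib-⊕ F G) a b c) (x·-distrib-⊕ (t· F) (t· G) a b c)))
          (regroup (F a b c) (G a b c) _ _ _ _)
    where
    regroup : ∀ f g p q r s → f + g - (p + q) + (r + s) ≡ f - p + r + (g - q + s)
    regroup = solve-∀

  [1-u]·-distrib-⊕ : ∀ F G → [1-u]· (F ⊕ G) ≈ [1-u]· F ⊕ [1-u]· G
  [1-u]·-distrib-⊕ F G a b c =
    trans (cong (λ p → F a b c + G a b c - p) (u·-distrib-⊕ F G a b c)) (regroup (F a b c) (G a b c) _ _)
    where
    regroup : ∀ f g p q → f + g - (p + q) ≡ f - p + (g - q)
    regroup = solve-∀

  Den·-distrib-⊕ : ∀ F G → Den· (F ⊕ G) ≈ Den· F ⊕ Den· G
  Den·-distrib-⊕ F G =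
    ≈-trans ([1-u]·-cong ([1-x+xt]·-distrib-⊕ F G)) ([1-u]·-distrib-⊕ ([1-x+xt]· F) ([1-x+xt]· G))

  [1-u]·-injective : ∀ {F G} → [1-u]· F ≈ [1-u]· G → F ≈ G
  [1-u]·-injective {F} {G} eq a zero    c = +-cancelʳ (+ 0) (F a 0 c) (G a 0 c) (eq a zero c)
  [1-u]·-injective {F} {G} eq a (suc b) c =
    +-cancelʳ (- F a b c) _ _ (trans (eq a (suc b) c)
      (cong (λ g → G a (suc b) c - g) (sym ([1-u]·-injective {F} {G} eq a b c))))

  [1-x+xt]·-injective : ∀ {F G} → [1-x+xt]· F ≈ [1-x+xt]· G → F ≈ G
  [1-x+xt]·-injective {F} {G} eq = agree
    where
    agree : F ≈ G
    agree-x· : x· F ≈ x· G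
    agree-x· zero    b c = refl
    agree-x· (suc a) b c = agree a b c
    agree-x·t· : x· t· F ≈ x· t· G
    agree-x·t· zero    b c       = refl
    agree-x·t· (suc a) b zero    = refl
    agree-x·t· (suc a) b (suc c) = agree a b c
    agree a b c = +-cancelʳ (- (x· F) a b c) _ _ (+-cancelʳ ((x· t· F) a b c) _ _ (trans (eq a b c)
      (cong₂ (λ p q → G a b c - p + q) (sym (agree-x· a b c)) (sym (agree-x·t· a b c)))))

  Den·-injective : ∀ {F G} → Den· F ≈ Den· G → F ≈ G
  Den·-injective = [1-x+xt]·-injective ∘ [1-u]·-injective

module SLSeries where

  open Recurrences
  open PowerSeries
  open import Data.Nat as ℕ using (ℕ; zero; suc)
  open import Data.Integer as ℤ using (ℤ; +_; _+_; _-_)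
  import Data.Integer.Properties as ℤ
  open import Data.Integer.Tactic.RingSolver using (solve-∀)
  open import Relation.Binary.PropositionalEquality

  Σᵤ : FPS → FPS
  Σᵤ F a b c = sumTo b (λ j → F a j c)

  [1-u]·-Σᵤ : ∀ F → [1-u]· Σᵤ F ≈ F
  [1-u]·-Σᵤ F a zero    c = ℤ.+-identityʳ (F a 0 c)
  [1-u]·-Σᵤ F a (suc b) c = telescope (Σᵤ F a b c) (F a (suc b) c)
    where
    telescope : ∀ s f → s + f - s ≡ f
    telescope = solve-∀

  𝒮-slCount : ∀ n m k → 𝒮 (suc n) m k ≡ + slCount n m k
  𝒮-slCount n m k = cong +_ (countWords-SL n m k)

  Σᵤ𝒩-avoidCount : ∀ n m k → Σᵤ 𝒩 (suc n) m k ≡ + avoidCount (suc n) m k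
  Σᵤ𝒩-avoidCount n zero    k = cong +_ (sym (avoidCount-zero (suc n) k))
  Σᵤ𝒩-avoidCount n (suc m) k = trans (cong (_+ 𝒩 (suc n) (suc m) k) (Σᵤ𝒩-avoidCount n m k))
                                     (cong +_ (sym (avoidCount-suc-max (suc n) m k)))

  slRecurrence : ∀ n m k →
    𝒮 (suc n) m k - 𝒮 n m k + (t· 𝒮) n m k ≡ 𝟙 n 0 k + Σᵤ (t· 𝒩) n m k
  slRecurrence zero m zero = begin
    𝒮 1 m 0 - + 0 + + 0  ≡⟨ cong (λ s → s - + 0 + + 0) (𝒮-slCount 0 m 0) ⟩
    + 1                  ≡⟨ cong (λ s → + 1 + s) (sumTo-zero m λ _ → refl) ⟨
    + 1 + Σᵤ (t· 𝒩) 0 m 0 ∎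
    where open ≡-Reasoning
  slRecurrence zero m (suc k) = begin
    𝒮 1 m (suc k) - + 0 + + 0   ≡⟨ cong (λ s → s - + 0 + + 0) (𝒮-slCount 0 m (suc k)) ⟩
    + 0                         ≡⟨ cong (λ s → + 0 + s) (sumTo-zero m λ _ → refl) ⟨
    + 0 + Σᵤ (t· 𝒩) 0 m (suc k) ∎
    where open ≡-Reasoning
  slRecurrence (suc n) m zero = begin
    𝒮 (2 ℕ.+ n) m 0 - 𝒮 (suc n) m 0 + + 0
                                            ≡⟨ cong₂ (λ x y → x - y + + 0) (𝒮-slCount (suc n) m 0) (𝒮-slCount n m 0) ⟩
    + s′ - + s + + 0                        ≡⟨ cong (λ x → + x - + s + + 0) (slCount-suc-zero n m) ⟩
    + s - + s + + 0                         ≡⟨ cancel (+ s) ⟩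
    + 0                                     ≡⟨ cong (λ x → + 0 + x) (sumTo-zero m λ _ → refl) ⟨
    + 0 + Σᵤ (t· 𝒩) (suc n) m 0             ∎
    where
    open ≡-Reasoning
    s′ s : ℕ
    s′ = slCount (suc n) m 0
    s  = slCount n m 0
    cancel : ∀ x → x - x + + 0 ≡ + 0
    cancel = solve-∀
  slRecurrence (suc n) m (suc k) = begin
    𝒮 (2 ℕ.+ n) m (suc k) - 𝒮 (suc n) m (suc k) + 𝒮 (suc n) m k
      ≡⟨ cong₂ (λ x y → x - y + 𝒮 (suc n) m k) (𝒮-slCount (suc n) m (suc k)) (𝒮-slCount n m (suc k)) ⟩
    + s′₁ - + s₁ + 𝒮 (suc n) m k
      ≡⟨ cong (λ x → + s′₁ - + s₁ + x) (𝒮-slCount n m k) ⟩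
    + s′₁ - + s₁ + + s₀
      ≡⟨ regroup (+ s′₁) (+ s₁) (+ s₀) ⟩
    + (s′₁ ℕ.+ s₀) - + s₁
      ≡⟨ cong (λ x → + x - + s₁) (slCount-suc-suc n m k) ⟩
    + (s₁ ℕ.+ a) - + s₁
      ≡⟨ telescope (+ s₁) (+ a) ⟩
    + 0 + + a
      ≡⟨ cong (λ x → + 0 + x) (Σᵤ𝒩-avoidCount n m k) ⟨
    + 0 + Σᵤ (t· 𝒩) (suc n) m (suc k)
      ∎
    where
    open ≡-Reasoning
    s′₁ s₁ s₀ a : ℕ
    s′₁ = slCount (suc n) m (suc k)
    s₁  = slCount n m (suc k)
    s₀  = slCount n m k
    a   = avoidCount (suc n) m k
    regroup : ∀ x y z → x - y + z ≡ x + z - y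
    regroup = solve-∀
    telescope : ∀ y w → y + w - y ≡ + 0 + w
    telescope = solve-∀

  𝟙-u-free : ∀ a b c → 𝟙 a (suc b) c ≡ + 0
  𝟙-u-free zero    b c = refl
  𝟙-u-free (suc a) b c = refl

  [1-x+xt]·-𝒮 : [1-x+xt]· 𝒮 ≈ x· Σᵤ (𝟙 ⊕ t· 𝒩)
  [1-x+xt]·-𝒮 zero    m k = refl
  [1-x+xt]·-𝒮 (suc n) m k = trans (slRecurrence n m k) (sym (begin
    Σᵤ (𝟙 ⊕ t· 𝒩) n m k         ≡⟨ sumTo-distrib-+ m (λ j → 𝟙 n j k) (λ j → (t· 𝒩) n j k) ⟩
    Σᵤ 𝟙 n m k + Σᵤ (t· 𝒩) n m k ≡⟨ cong (_+ Σᵤ (t· 𝒩) n m k) (sumTo-head m _ (λ j → 𝟙-u-free n j k)) ⟩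
    𝟙 n 0 k + Σᵤ (t· 𝒩) n m k    ∎))
    where open ≡-Reasoning

  Den·-𝒮 : Den· 𝒮 ≈ x· (𝟙 ⊕ t· 𝒩)
  Den·-𝒮 = begin
    [1-u]· [1-x+xt]· 𝒮          ≈⟨ [1-u]·-cong [1-x+xt]·-𝒮 ⟩
    [1-u]· x· Σᵤ (𝟙 ⊕ t· 𝒩)     ≈⟨ [1-u]·-x· (Σᵤ (𝟙 ⊕ t· 𝒩)) ⟩
    x· [1-u]· Σᵤ (𝟙 ⊕ t· 𝒩)     ≈⟨ x·-cong ([1-u]·-Σᵤ (𝟙 ⊕ t· 𝒩)) ⟩
    x· (𝟙 ⊕ t· 𝒩)               ∎
    where open import Relation.Binary.Reasoning.Setoid ≈-setoid

  -- 1/((1 − u)(1 − x + xt)) = Σ_b u^b Σ_a x^a (1 − t)^a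
  invCoeff : ℕ → ℕ → ℤ
  invCoeff zero    zero    = + 1
  invCoeff zero    (suc c) = + 0
  invCoeff (suc a) zero    = invCoeff a 0
  invCoeff (suc a) (suc c) = invCoeff a (suc c) - invCoeff a c

  Den⁻¹ : FPS
  Den⁻¹ a b c = invCoeff a c

  [1-x+xt]·-Den⁻¹ : ∀ a b c → ([1-x+xt]· Den⁻¹) a b c ≡ 𝟙 a 0 c
  [1-x+xt]·-Den⁻¹ zero    b zero    = refl
  [1-x+xt]·-Den⁻¹ zero    b (suc c) = refl
  [1-x+xt]·-Den⁻¹ (suc a) b zero    = cancel (invCoeff a 0)
    where
    cancel : ∀ x → x - x + + 0 ≡ + 0
    cancel = solve-∀
  [1-x+xt]·-Den⁻¹ (suc a) b (suc c) = cancel (invCoeff a (suc c)) (invCoeff a c)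
    where
    cancel : ∀ x y → x - y - x + y ≡ + 0
    cancel = solve-∀

  Den·-Den⁻¹ : Den· Den⁻¹ ≈ 𝟙
  Den·-Den⁻¹ a zero    c = trans (ℤ.+-identityʳ _) ([1-x+xt]·-Den⁻¹ a 0 c)
  Den·-Den⁻¹ a (suc b) c = trans (cong₂ _-_ ([1-x+xt]·-Den⁻¹ a (suc b) c) ([1-x+xt]·-Den⁻¹ a b c))
                                 (trans (ℤ.+-inverseʳ (𝟙 a 0 c)) (sym (𝟙-u-free a b c)))

  Den·-closedForm : ∀ I → Den· I ≈ 𝟙 → Den· (X ⊛ I ⊕ X ⊛ T ⊛ I ⊛ 𝒩) ≈ x· (𝟙 ⊕ t· 𝒩)
  Den·-closedForm I inv = begin
    Den· (X ⊛ I ⊕ X ⊛ T ⊛ I ⊛ 𝒩)         ≈⟨ Den·-distrib-⊕ (X ⊛ I) (X ⊛ T ⊛ I ⊛ 𝒩) ⟩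
    Den· (X ⊛ I) ⊕ Den· (X ⊛ T ⊛ I ⊛ 𝒩)  ≈⟨ ⊕-cong x-part xt-part ⟩
    x· 𝟙 ⊕ x· t· 𝒩                        ≈⟨ x·-distrib-⊕ 𝟙 (t· 𝒩) ⟨
    x· (𝟙 ⊕ t· 𝒩)                         ∎
    where
    open import Relation.Binary.Reasoning.Setoid ≈-setoid
    x-part : Den· (X ⊛ I) ≈ x· 𝟙
    x-part = begin
      Den· (X ⊛ I)  ≈⟨ Den·-cong (X-⊛ I) ⟩
      Den· x· I     ≈⟨ Den·-x· I ⟩
      x· Den· I     ≈⟨ x·-cong inv ⟩
      x· 𝟙          ∎
    XT⊛I : X ⊛ T ⊛ I ≈ x· t· I
    XT⊛I = ≈-trans (⊛-congʳ I (X-⊛ T)) (≈-trans (x·-⊛ T I) (x·-cong (T-⊛ I)))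
    x·t·-inverse : Den· x· t· I ≈ x· t· 𝟙
    x·t·-inverse = ≈-trans (Den·-x· (t· I)) (x·-cong (≈-trans (Den·-t· I) (t·-cong inv)))
    xt-part : Den· (X ⊛ T ⊛ I ⊛ 𝒩) ≈ x· t· 𝒩
    xt-part = begin
      Den· ((X ⊛ T ⊛ I) ⊛ 𝒩)   ≈⟨ Den·-cong (⊛-congʳ 𝒩 XT⊛I) ⟩
      Den· ((x· t· I) ⊛ 𝒩)     ≈⟨ Den·-⊛ (x· t· I) 𝒩 ⟨
      (Den· x· t· I) ⊛ 𝒩       ≈⟨ ⊛-congʳ 𝒩 x·t·-inverse ⟩
      (x· t· 𝟙) ⊛ 𝒩            ≈⟨ x·-⊛ (t· 𝟙) 𝒩 ⟩
      x· ((t· 𝟙) ⊛ 𝒩)          ≈⟨ x·-cong (≈-trans (t·-⊛ 𝟙 𝒩) (t·-cong (𝟙-⊛ 𝒩))) ⟩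
      x· t· 𝒩                  ∎

open import Data.Product using (_,_)
open PowerSeries using (≈-trans; ≈-sym; Den·_; Den-⊛; Den·-injective)
open SLSeries using (Den⁻¹; Den·-Den⁻¹; Den·-𝒮; Den·-closedForm)

mainTheorem8 : Σ FPS (λ I → Den ⊛ I ≈ 𝟙)
               × ((I : FPS) → Den ⊛ I ≈ 𝟙 → 𝒮 ≈ X ⊛ I ⊕ X ⊛ T ⊛ I ⊛ 𝒩)
mainTheorem8 = (Den⁻¹ , ≈-trans (Den-⊛ Den⁻¹) Den·-Den⁻¹) , closedForm
  where
  closedForm : (I : FPS) → Den ⊛ I ≈ 𝟙 → 𝒮 ≈ X ⊛ I ⊕ X ⊛ T ⊛ I ⊛ 𝒩
  closedForm I Den⊛I≈𝟙 = Den·-injective (≈-trans Den·-𝒮 (≈-sym (Den·-closedForm I Den·I≈𝟙)))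
    where
    Den·I≈𝟙 : Den· I ≈ 𝟙
    Den·I≈𝟙 = ≈-trans (≈-sym (Den-⊛ I)) Den⊛I≈𝟙
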